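{- Let $k\ge 2$ and $m\ge 3$ be integers with $m\ge 2k-1$. Suppose $N$ and $d$ are positive integers such that $N,N+d,\ldots,N+(m-1)d$ are all $k$-full. Let $a_{i,j}$ ($k\le i\le 2k-1$, $0\le j\le m-1$) be positive integers such that $$N+jd=\prod_{i=k}^{2k-1} a_{i,j}^{\,i}\qquad (0\le j\le m-1),$$ and write $t=\gcd(N,d)$. Then $$\mathrm{Rad}\left(\frac{N}{t}\cdot\frac{N+d}{t}\cdots\frac{N+(m-1)d}{t}\right)\le C_m\,\frac{\prod_{j=0}^{m-1}\prod_{i=k}^{2k-1} a_{i,j}}{t^{m/(2k-1)}},\qquad\text{where } C_m=\prod_{p\le m,\ p\text{ prime}} p.$$
   Context: For an integer $k\ge 2$, a positive integer $n$ is called $k$-full if every prime $p$ dividing $n$ satisfies $p^k\mid n$. $\mathrm{Rad}(n)$ denotes the product of the distinct primes dividing $n$. (Every $k$-full number admits such a representation $\prod_{i=k}^{2k-1}a_i^{\,i}$ with positive integers $a_i$.) -}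

module Defs where

open import Data.Nat using (ℕ; zero; suc; _+_; _*_; _^_)
open import Data.Nat.Divisibility using (_∣_; _∣?_)
open import Data.Nat.Primality using (Prime; prime?)
open import Data.Fin using (Fin; toℕ)
open import Data.Bool using (if_then_else_; _∧_)
open import Relation.Nullary using (does)

∏ : (n : ℕ) → (Fin n → ℕ) → ℕ
∏ zero    f = 1
∏ (suc n) f = f Fin.zero * ∏ n (λ i → f (Fin.suc i))

KFull : ℕ → ℕ → Set
KFull k n = ∀ p → Prime p → p ∣ n → p ^ k ∣ n

radUpTo : ℕ → ℕ → ℕ
radUpTo n zero    = 1
radUpTo n (suc b) =
  (if does (prime? (suc b)) ∧ does (suc b ∣? n) then suc b else 1) * radUpTo n b

-- Rad n : product of the distinct primes dividing n (for n ≥ 1 all such primes are ≤ n)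
Rad : ℕ → ℕ
Rad n = radUpTo n n

primeProdUpTo : ℕ → ℕ
primeProdUpTo zero    = 1
primeProdUpTo (suc b) =
  (if does (prime? (suc b)) then suc b else 1) * primeProdUpTo b

module Submission where

-- Fix a prime p and put s = 2k − 1, e = v_p(t), α_j = v_p(∏_i a_{i,j}) and
-- ρ = v_p(Rad ∏_j (N + jd)/t) ∈ {0, 1}. Every exponent i in the representation
-- is at most s, so e ≤ v_p(N + jd) ≤ s α_j for all j. If ρ = 1, then p divides
-- some (N + jd)/t, so e < s α_j for that j; since the s α_j are multiples of s
-- and s ≤ m, this forces s + m e ≤ s Σ_j α_j.

open import Data.Fin.Base using (Fin; toℕ; zero; suc; punchIn)
open import Data.Fin.Properties using (toℕ<n)
open import Data.List.Base using ([]; _∷_)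
open import Data.List.Relation.Unary.All using (All; []; _∷_)
open import Data.Nat.Base
open import Data.Nat.Divisibility
open import Data.Nat.DivMod using (m/n*n≡m)
open import Data.Nat.GCD using (gcd; gcd[m,n]∣m; gcd[m,n]∣n)
open import Data.Nat.ListAction using (product)
open import Data.Nat.Primality
open import Data.Nat.Primality.Factorisation using (PrimeFactorisation; factorise)
open import Data.Nat.Properties
open import Data.Product.Base using (∃-syntax; _×_; _,_; proj₁; proj₂; map₁)
open import Data.Sum.Base using (_⊎_; [_,_]′; inj₁; inj₂)
open import Data.Vec.Functional using (Vector; removeAt)
open import Function.Base using (_∘_; id)
open import Relation.Binary.PropositionalEquality
open import Relation.Nullary.Decidable using (yes; no; dec-true; dec-false)
open import Relation.Nullary.Negation.Core using (contradiction)

open import Algebra.Properties.CommutativeSemigroup *-commutativeSemigroup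
  using () renaming (interchange to *-interchange)
open import Algebra.Properties.Semiring.Sum +-*-semiring
  using (sum; sum-cong-≗; sum-remove; *-distribˡ-sum)
open import Defs

private
  variable
    m n x y : ℕ

*-pos : 0 < m → 0 < n → 0 < m * n
*-pos = *-mono-≤

^-pos : 0 < m → ∀ n → 0 < m ^ n
^-pos 0<m zero    = ≤-refl
^-pos 0<m (suc n) = *-pos 0<m (^-pos 0<m n)

∏-pos : ∀ n (f : Vector ℕ n) → (∀ j → 0 < f j) → 0 < ∏ n f
∏-pos zero    f 0<f = ≤-refl
∏-pos (suc n) f 0<f = *-pos (0<f zero) (∏-pos n (f ∘ suc) (0<f ∘ suc))

divisor-pos : 0 < n → m ∣ n → 0 < m
divisor-pos {m = zero}  0<n 0∣n = contradiction (0∣⇒≡0 0∣n) (n>0⇒n≢0 0<n)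
divisor-pos {m = suc m} _   _   = z<s

^-monoʳ-∣ : ∀ p {a b} → a ≤ b → p ^ a ∣ p ^ b
^-monoʳ-∣ p {a} a≤b = subst (λ c → p ^ a ∣ p ^ c) (m+[n∸m]≡n a≤b)
  (subst (p ^ a ∣_) (sym (^-distribˡ-+-* p a _)) (m∣m*n _))

countFactors : ℕ → ℕ → ℕ → ℕ
countFactors p zero       x = 0
countFactors p (suc fuel) x with p ∣? x
... | yes p∣x = suc (countFactors p fuel (quotient p∣x))
... | no  _   = 0

-- Fuel x suffices for the p-adic valuation, since each division by p ≥ 2
-- decreases x; the value is junk for x = 0 or p < 2.
valuation : ℕ → ℕ → ℕ
valuation p x = countFactors p x x

module _ {p : ℕ} (p-prime : Prime p) where

  private instance
    p≢0 : NonZero p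
    p≢0 = prime⇒nonZero p-prime
    p>1 : NonTrivial p
    p>1 = prime⇒nonTrivial p-prime

  p∤1 : p ∤ 1
  p∤1 p∣1 = nonTrivial⇒≢1 (∣1⇒≡1 p∣1)

  p∣p^[1+e]*r : ∀ e r → p ∣ p ^ suc e * r
  p∣p^[1+e]*r e r = ∣m⇒∣m*n r (m∣m*n (p ^ e))

  countFactors-split : ∀ fuel x → 0 < x → x ≤ fuel →
                       ∃[ r ] x ≡ p ^ countFactors p fuel x * r × p ∤ r
  countFactors-split zero       x 0<x x≤0 = contradiction (n≤0⇒n≡0 x≤0) (n>0⇒n≢0 0<x)
  countFactors-split (suc fuel) x 0<x x≤1+fuel with p ∣? x
  ... | no  p∤x = x , sym (+-identityʳ x) , p∤x
  ... | yes p∣x@(divides q _) =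
    let r , q≡ , p∤r = countFactors-split fuel q 0<q (≤-pred (<-≤-trans q<x x≤1+fuel))
    in  r , trans (m∣n⇒n≡m*quotient p∣x) (trans (cong (p *_) q≡) (sym (*-assoc p _ r))) , p∤r
    where
    instance x≢0 = >-nonZero 0<x
    q<x : q < x
    q<x = quotient-< p∣x
    0<q : 0 < q
    0<q = >-nonZero⁻¹ q {{quotient≢0 p∣x}}

  valuation-split : 0 < x → ∃[ r ] x ≡ p ^ valuation p x * r × p ∤ r
  valuation-split {x} 0<x = countFactors-split x x 0<x ≤-refl

  exponent-unique : ∀ a b {r s} → p ^ a * r ≡ p ^ b * s → p ∤ r → p ∤ s → a ≡ b
  exponent-unique zero    zero    _  _   _   = refl
  exponent-unique zero    (suc b) eq p∤r _   =
    contradiction (subst (p ∣_) (trans (sym eq) (+-identityʳ _)) (p∣p^[1+e]*r b _)) p∤r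
  exponent-unique (suc a) zero    eq _   p∤s =
    contradiction (subst (p ∣_) (trans eq (+-identityʳ _)) (p∣p^[1+e]*r a _)) p∤s
  exponent-unique (suc a) (suc b) {r} {s} eq p∤r p∤s =
    cong suc (exponent-unique a b (*-cancelˡ-≡ _ _ p p*[p^a*r]≡p*[p^b*s]) p∤r p∤s)
    where
    p*[p^a*r]≡p*[p^b*s] : p * (p ^ a * r) ≡ p * (p ^ b * s)
    p*[p^a*r]≡p*[p^b*s] = trans (sym (*-assoc p _ r)) (trans eq (*-assoc p _ s))

  valuation-unique : ∀ e {r} → 0 < x → x ≡ p ^ e * r → p ∤ r → valuation p x ≡ e
  valuation-unique e 0<x x≡ p∤r =
    let r′ , x≡′ , p∤r′ = valuation-split 0<x
    in  exponent-unique _ e (trans (sym x≡′) x≡) p∤r′ p∤r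

  valuation-≡0 : 0 < x → p ∤ x → valuation p x ≡ 0
  valuation-≡0 {x} 0<x = valuation-unique 0 0<x (sym (+-identityʳ x))

  valuation-1 : valuation p 1 ≡ 0
  valuation-1 = valuation-≡0 z<s p∤1

  valuation-self : valuation p p ≡ 1
  valuation-self = valuation-unique 1 (>-nonZero⁻¹ p)
    (sym (trans (*-identityʳ (p * 1)) (*-identityʳ p))) p∤1

  valuation-* : 0 < x → 0 < y → valuation p (x * y) ≡ valuation p x + valuation p y
  valuation-* {x} {y} 0<x 0<y =
    let r , x≡ , p∤r = valuation-split 0<x
        s , y≡ , p∤s = valuation-split 0<y
        a = valuation p x ; b = valuation p y
        xy≡ : x * y ≡ p ^ (a + b) * (r * s)
        xy≡ = begin
          x * y                   ≡⟨ cong₂ _*_ x≡ y≡ ⟩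
          p ^ a * r * (p ^ b * s) ≡⟨ *-interchange (p ^ a) r (p ^ b) s ⟩
          p ^ a * p ^ b * (r * s) ≡⟨ cong (_* (r * s)) (^-distribˡ-+-* p a b) ⟨
          p ^ (a + b) * (r * s)   ∎
    in  valuation-unique (a + b) (*-pos 0<x 0<y) xy≡
          (λ p∣rs → [ p∤r , p∤s ]′ (euclidsLemma r s p-prime p∣rs))
    where open ≡-Reasoning

  valuation-^ : 0 < x → ∀ n → valuation p (x ^ n) ≡ n * valuation p x
  valuation-^     0<x zero    = valuation-1
  valuation-^ {x} 0<x (suc n) = trans (valuation-* 0<x (^-pos 0<x n))
                                      (cong (valuation p x +_) (valuation-^ 0<x n))

  valuation-∏ : ∀ n (f : Vector ℕ n) → (∀ j → 0 < f j) →
                valuation p (∏ n f) ≡ sum (λ j → valuation p (f j))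
  valuation-∏ zero    f 0<f = valuation-1
  valuation-∏ (suc n) f 0<f =
    trans (valuation-* (0<f zero) (∏-pos n (f ∘ suc) (0<f ∘ suc)))
          (cong (valuation p (f zero) +_) (valuation-∏ n (f ∘ suc) (0<f ∘ suc)))

  ^∣⇒≤valuation : ∀ {e} → 0 < x → p ^ e ∣ x → e ≤ valuation p x
  ^∣⇒≤valuation {x} {e} 0<x p^e∣x =
    let r , x≡ , p∤r = valuation-split 0<x
        v = valuation p x
    in  ≮⇒≥ λ v<e → p∤r (*-cancelˡ-∣ (p ^ v) {{m^n≢0 p v}}
          (subst₂ _∣_ (*-comm p (p ^ v)) x≡ (∣-trans (^-monoʳ-∣ p v<e) p^e∣x)))

  ≤valuation⇒^∣ : ∀ {e} → 0 < x → e ≤ valuation p x → p ^ e ∣ x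
  ≤valuation⇒^∣ {x} 0<x e≤v =
    let r , x≡ , _ = valuation-split 0<x
    in  subst (_ ∣_) (sym x≡) (∣m⇒∣m*n r (^-monoʳ-∣ p e≤v))

  ∣⇒valuation>0 : 0 < x → p ∣ x → 0 < valuation p x
  ∣⇒valuation>0 {x} 0<x p∣x = ^∣⇒≤valuation 0<x (subst (_∣ x) (sym (*-identityʳ p)) p∣x)

  valuation>0⇒∣ : 0 < x → 0 < valuation p x → p ∣ x
  valuation>0⇒∣ {x} 0<x v>0 = subst (_∣ x) (*-identityʳ p) (≤valuation⇒^∣ 0<x v>0)

  ∣⇒valuation-≤ : 0 < y → x ∣ y → valuation p x ≤ valuation p y
  ∣⇒valuation-≤ 0<y x∣y =
    ^∣⇒≤valuation 0<y (∣-trans (≤valuation⇒^∣ (divisor-pos 0<y x∣y) ≤-refl) x∣y)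

product-∣ : ∀ {ps} → All Prime ps → 0 < y →
            (∀ {p} → Prime p → valuation p (product ps) ≤ valuation p y) →
            product ps ∣ y
product-∣ []                                   _   _  = 1∣ _
product-∣ {y} {p ∷ ps} (p-prime ∷ ps-prime) 0<y v≤ =
  m∣n/o⇒o*m∣n p∣y (product-∣ ps-prime 0<y/p v≤y/p)
  where
  instance _ = prime⇒nonZero p-prime
  0<p : 0 < p
  0<p = >-nonZero⁻¹ p
  0<P : 0 < product ps
  0<P = productOfPrimes≥1 ps-prime
  p∣y : p ∣ y
  p∣y = valuation>0⇒∣ p-prime 0<y
          (≤-trans (∣⇒valuation>0 p-prime (*-pos 0<p 0<P) (m∣m*n _)) (v≤ p-prime))
  0<y/p : 0 < y / p
  0<y/p = divisor-pos 0<y (m/n∣m p∣y)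
  v≤y/p : ∀ {q} → Prime q → valuation q (product ps) ≤ valuation q (y / p)
  v≤y/p {q} q-prime = +-cancelˡ-≤ (valuation q p) _ _ (begin
    valuation q p + valuation q (product ps) ≡⟨ valuation-* q-prime 0<p 0<P ⟨
    valuation q (p * product ps)             ≤⟨ v≤ q-prime ⟩
    valuation q y                            ≡⟨ cong (valuation q) (m/n*n≡m p∣y) ⟨
    valuation q (y / p * p)                  ≡⟨ valuation-* q-prime 0<y/p 0<p ⟩
    valuation q (y / p) + valuation q p      ≡⟨ +-comm _ (valuation q p) ⟩
    valuation q p + valuation q (y / p)      ∎)
    where open ≤-Reasoning

valuation-≤⇒∣ : 0 < x → 0 < y →
                (∀ {p} → Prime p → valuation p x ≤ valuation p y) → x ∣ y
valuation-≤⇒∣ {x} {y} 0<x 0<y v≤ = subst (_∣ y) (sym isFactorisation)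
  (product-∣ factorsPrime 0<y
    (λ p-prime → subst (λ z → valuation _ z ≤ valuation _ y) isFactorisation (v≤ p-prime)))
  where open PrimeFactorisation (factorise x {{>-nonZero 0<x}})

radUpTo-suc : ∀ n b → (Prime (suc b) × suc b ∣ n × radUpTo n (suc b) ≡ suc b * radUpTo n b)
                     ⊎ radUpTo n (suc b) ≡ radUpTo n b
radUpTo-suc n b with prime? (suc b) | suc b ∣? n
... | yes b+1-prime | yes b+1∣n rewrite dec-true (suc b ∣? n) b+1∣n =
  inj₁ (b+1-prime , b+1∣n , refl)
... | yes _ | no b+1∤n rewrite dec-false (suc b ∣? n) b+1∤n = inj₂ (+-identityʳ _)
... | no  _ | _                                              = inj₂ (+-identityʳ _)

radUpTo-pos : ∀ n b → 0 < radUpTo n b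
radUpTo-pos n zero    = z<s
radUpTo-pos n (suc b) with radUpTo-suc n b
... | inj₁ (_ , _ , R≡) = subst (0 <_) (sym R≡) (*-pos (z<s {n = b}) (radUpTo-pos n b))
... | inj₂ R≡           = subst (0 <_) (sym R≡) (radUpTo-pos n b)

primeProdUpTo-pos : ∀ b → 0 < primeProdUpTo b
primeProdUpTo-pos zero    = z<s
primeProdUpTo-pos (suc b) with prime? (suc b)
... | yes _ = *-pos (z<s {n = b}) (primeProdUpTo-pos b)
... | no  _ = *-pos (z<s {n = 0}) (primeProdUpTo-pos b)

prime-∣-prime⇒≡ : ∀ {p q} → Prime p → Prime q → p ∣ q → p ≡ q
prime-∣-prime⇒≡ p-prime q-prime p∣q =
  [ (λ p≡1 → contradiction p≡1 (nonTrivial⇒≢1 {{prime⇒nonTrivial p-prime}})) , id ]′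
    (prime⇒irreducible q-prime p∣q)

module _ {p : ℕ} (p-prime : Prime p) where

  ∣radUpTo⇒≤×∣ : ∀ n b → p ∣ radUpTo n b → p ≤ b × p ∣ n
  ∣radUpTo⇒≤×∣ n zero    p∣1 = contradiction p∣1 (p∤1 p-prime)
  ∣radUpTo⇒≤×∣ n (suc b) p∣R with radUpTo-suc n b
  ... | inj₂ R≡ = map₁ m≤n⇒m≤1+n (∣radUpTo⇒≤×∣ n b (subst (p ∣_) R≡ p∣R))
  ... | inj₁ (b+1-prime , b+1∣n , R≡)
        with euclidsLemma (suc b) _ p-prime (subst (p ∣_) R≡ p∣R)
  ...   | inj₁ p∣b+1 = let p≡b+1 = prime-∣-prime⇒≡ p-prime b+1-prime p∣b+1
                      in  ≤-reflexive p≡b+1 , subst (_∣ n) (sym p≡b+1) b+1∣n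
  ...   | inj₂ p∣R′ = map₁ m≤n⇒m≤1+n (∣radUpTo⇒≤×∣ n b p∣R′)

  ∣∏⇒∣ : ∀ n (f : Vector ℕ n) → p ∣ ∏ n f → ∃[ j ] p ∣ f j
  ∣∏⇒∣ zero    f p∣1 = contradiction p∣1 (p∤1 p-prime)
  ∣∏⇒∣ (suc n) f p∣∏ with euclidsLemma (f zero) _ p-prime p∣∏
  ... | inj₁ p∣f₀ = zero , p∣f₀
  ... | inj₂ p∣∏′ = let j , p∣fⱼ₊₁ = ∣∏⇒∣ n (f ∘ suc) p∣∏′
                    in  suc j , p∣fⱼ₊₁

  valuation-radUpTo≤1 : ∀ n b → valuation p (radUpTo n b) ≤ 1
  valuation-radUpTo≤1 n zero    = subst (_≤ 1) (sym (valuation-1 p-prime)) z≤n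
  valuation-radUpTo≤1 n (suc b) with radUpTo-suc n b
  ... | inj₂ R≡ = subst (λ R → valuation p R ≤ 1) (sym R≡) (valuation-radUpTo≤1 n b)
  ... | inj₁ (b+1-prime , _ , R≡) = begin
    valuation p (radUpTo n (suc b))                 ≡⟨ cong (valuation p) R≡ ⟩
    valuation p (suc b * radUpTo n b)               ≡⟨ valuation-* p-prime z<s (radUpTo-pos n b) ⟩
    valuation p (suc b) + valuation p (radUpTo n b) ≤⟨ new-factor ⟩
    1                                               ∎
    where
    open ≤-Reasoning
    new-factor : valuation p (suc b) + valuation p (radUpTo n b) ≤ 1
    new-factor with p ≟ suc b
    ... | yes refl = ≤-reflexive (cong₂ _+_ (valuation-self p-prime)
                       (valuation-≡0 p-prime (radUpTo-pos n b)
                         (<⇒≱ (n<1+n b) ∘ proj₁ ∘ ∣radUpTo⇒≤×∣ n b)))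
    ... | no p≢b+1 = subst (λ v → v + valuation p (radUpTo n b) ≤ 1)
                       (sym (valuation-≡0 p-prime z<s
                         (p≢b+1 ∘ prime-∣-prime⇒≡ p-prime b+1-prime)))
                       (valuation-radUpTo≤1 n b)

sum-mono-≤ : ∀ {n} {f g : Vector ℕ n} → (∀ j → f j ≤ g j) → sum f ≤ sum g
sum-mono-≤ {zero}  _   = z≤n
sum-mono-≤ {suc n} f≤g = +-mono-≤ (f≤g zero) (sum-mono-≤ (f≤g ∘ suc))

*≤sum : ∀ {n c} {f : Vector ℕ n} → (∀ j → c ≤ f j) → n * c ≤ sum f
*≤sum {zero}  _   = z≤n
*≤sum {suc n} c≤f = +-mono-≤ (c≤f zero) (*≤sum (c≤f ∘ suc))

+*≤sum : ∀ {n c δ} {f : Vector ℕ n} (i : Fin n) →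
         (∀ j → c ≤ f j) → δ + c ≤ f i → δ + n * c ≤ sum f
+*≤sum {suc n} {c} {δ} {f} i c≤f δ+c≤fᵢ = begin
  δ + (c + n * c)          ≡⟨ +-assoc δ c (n * c) ⟨
  δ + c + n * c            ≤⟨ +-mono-≤ δ+c≤fᵢ (*≤sum (c≤f ∘ punchIn i)) ⟩
  f i + sum (removeAt f i) ≡⟨ sum-remove {i = i} f ⟨
  sum f                    ∎
  where open ≤-Reasoning

multiples-<⇒+≤ : ∀ {s e b} → s ∣ e → s ∣ b → e < b → s + e ≤ b
multiples-<⇒+≤ {s} (divides c refl) (divides d refl) cs<ds =
  *-monoˡ-≤ s (*-cancelʳ-< s c d cs<ds)

+*≤sum-of-multiples : ∀ {m s e} {β : Vector ℕ m} → s ≤ m → (∀ j → s ∣ β j) →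
                      (∀ j → e ≤ β j) → ∃[ i ] e < β i → s + m * e ≤ sum β
+*≤sum-of-multiples {m} {s} {e} {β} s≤m s∣β e≤β (i , e<βᵢ) with s ∣? e
... | yes s∣e = +*≤sum i e≤β (multiples-<⇒+≤ s∣e (s∣β i) e<βᵢ)
... | no  s∤e = begin
  s + m * e ≤⟨ +-monoˡ-≤ (m * e) s≤m ⟩
  m + m * e ≡⟨ *-suc m e ⟨
  m * suc e ≤⟨ *≤sum e<β ⟩
  sum β     ∎
  where
  open ≤-Reasoning
  e<β : ∀ j → e < β j
  e<β j = ≤∧≢⇒< (e≤β j) (λ e≡βⱼ → s∤e (subst (s ∣_) (sym e≡βⱼ) (s∣β j)))

valuation-∏^≤ : ∀ {p s} → Prime p → ∀ n (a e : Vector ℕ n) →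
                (∀ r → 0 < a r) → (∀ r → e r ≤ s) →
                valuation p (∏ n (λ r → a r ^ e r)) ≤ s * valuation p (∏ n a)
valuation-∏^≤ {p} {s} p-prime n a e 0<a e≤s = begin
  valuation p (∏ n (λ r → a r ^ e r)) ≡⟨ valuation-∏ p-prime n _ (λ r → ^-pos (0<a r) (e r)) ⟩
  sum (λ r → valuation p (a r ^ e r)) ≡⟨ sum-cong-≗ (λ r → valuation-^ p-prime (0<a r) (e r)) ⟩
  sum (λ r → e r * valuation p (a r)) ≤⟨ sum-mono-≤ (λ r → *-monoˡ-≤ (α r) (e≤s r)) ⟩
  sum (λ r → s * α r)                 ≡⟨ *-distribˡ-sum s α ⟨
  s * sum α                           ≡⟨ cong (s *_) (valuation-∏ p-prime n a 0<a) ⟨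
  s * valuation p (∏ n a)             ∎
  where
  open ≤-Reasoning
  α : Vector ℕ n
  α r = valuation p (a r)

Rad[∏M/t]^s*t^m∣[∏A]^s : ∀ {m s t} (M A : Vector ℕ m) .{{_ : NonZero t}} → s ≤ m →
  (∀ j → 0 < M j) → (∀ j → 0 < A j) → (∀ j → t ∣ M j) →
  (∀ {p} → Prime p → ∀ j → valuation p (M j) ≤ s * valuation p (A j)) →
  Rad (∏ m (λ j → M j / t)) ^ s * t ^ m ∣ ∏ m A ^ s
Rad[∏M/t]^s*t^m∣[∏A]^s {m} {s} {t} M A s≤m 0<M 0<A t∣M vM≤vA =
  valuation-≤⇒∣ (*-pos 0<Rad^s 0<t^m) (^-pos (∏-pos m A 0<A) s) valuation-≤
  where
  0<t : 0 < t
  0<t = >-nonZero⁻¹ t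
  M/t : Vector ℕ m
  M/t j = M j / t
  0<M/t : ∀ j → 0 < M/t j
  0<M/t j = divisor-pos (0<M j) (m/n∣m (t∣M j))
  P : ℕ
  P = ∏ m M/t
  0<Rad : 0 < Rad P
  0<Rad = radUpTo-pos P P
  0<Rad^s : 0 < Rad P ^ s
  0<Rad^s = ^-pos 0<Rad s
  0<t^m : 0 < t ^ m
  0<t^m = ^-pos 0<t m
  valuation-≤ : ∀ {p} → Prime p → valuation p (Rad P ^ s * t ^ m) ≤ valuation p (∏ m A ^ s)
  valuation-≤ {p} p-prime = begin
    valuation p (Rad P ^ s * t ^ m)               ≡⟨ valuation-* p-prime 0<Rad^s 0<t^m ⟩
    valuation p (Rad P ^ s) + valuation p (t ^ m) ≡⟨ cong₂ _+_ (valuation-^ p-prime 0<Rad s)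
                                                                (valuation-^ p-prime 0<t m) ⟩
    s * ρ + m * e                                 ≤⟨ bound ⟩
    sum β                                         ≡⟨ *-distribˡ-sum s α ⟨
    s * sum α                                     ≡⟨ cong (s *_) (valuation-∏ p-prime m A 0<A) ⟨
    s * valuation p (∏ m A)                       ≡⟨ valuation-^ p-prime (∏-pos m A 0<A) s ⟨
    valuation p (∏ m A ^ s)                       ∎
    where
    open ≤-Reasoning
    e ρ : ℕ
    e = valuation p t
    ρ = valuation p (Rad P)
    α β : Vector ℕ m
    α j = valuation p (A j)
    β j = s * α j
    e≤β : ∀ j → e ≤ β j
    e≤β j = ≤-trans (∣⇒valuation-≤ p-prime (0<M j) (t∣M j)) (vM≤vA p-prime j)
    bound : s * ρ + m * e ≤ sum β
    bound with p ∣? Rad P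
    ... | no p∤Rad = begin
      s * ρ + m * e ≡⟨ cong (λ ρ → s * ρ + m * e) (valuation-≡0 p-prime 0<Rad p∤Rad) ⟩
      s * 0 + m * e ≡⟨ cong (_+ m * e) (*-zeroʳ s) ⟩
      m * e         ≤⟨ *≤sum e≤β ⟩
      sum β         ∎
    ... | yes p∣Rad = begin
      s * ρ + m * e ≡⟨ cong (λ ρ → s * ρ + m * e) ρ≡1 ⟩
      s * 1 + m * e ≡⟨ cong (_+ m * e) (*-identityʳ s) ⟩
      s + m * e     ≤⟨ +*≤sum-of-multiples s≤m (λ j → m∣m*n (α j)) e≤β e<β ⟩
      sum β         ∎
      where
      ρ≡1 : ρ ≡ 1
      ρ≡1 = ≤-antisym (valuation-radUpTo≤1 p-prime P P) (∣⇒valuation>0 p-prime 0<Rad p∣Rad)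
      e<β : ∃[ i ] e < β i
      e<β =
        let i , p∣M/tᵢ = ∣∏⇒∣ p-prime m M/t (proj₂ (∣radUpTo⇒≤×∣ p-prime P P p∣Rad))
        in  i , (begin-strict
              e                       <⟨ m<n+m e (∣⇒valuation>0 p-prime (0<M/t i) p∣M/tᵢ) ⟩
              valuation p (M/t i) + e ≡⟨ valuation-* p-prime (0<M/t i) 0<t ⟨
              valuation p (M/t i * t) ≡⟨ cong (valuation p) (m/n*n≡m (t∣M i)) ⟩
              valuation p (M i)       ≤⟨ vM≤vA p-prime i ⟩
              β i                     ∎)

lemma2 : (k m N d : ℕ) → 2 ≤ k → 3 ≤ m → 2 * k ∸ 1 ≤ m → 1 ≤ N → 1 ≤ d →
         ((j : Fin m) → KFull k (N + toℕ j * d)) →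
         (a : Fin k → Fin m → ℕ) →
         ((r : Fin k) → (j : Fin m) → 1 ≤ a r j) →
         ((j : Fin m) → N + toℕ j * d ≡ ∏ k (λ r → a r j ^ (k + toℕ r))) →
         .{{_ : NonZero (gcd N d)}} →
         Rad (∏ m (λ j → (N + toℕ j * d) / gcd N d)) ^ (2 * k ∸ 1) * gcd N d ^ m
           ≤ primeProdUpTo m ^ (2 * k ∸ 1) * ∏ m (λ j → ∏ k (λ r → a r j)) ^ (2 * k ∸ 1)
lemma2 k m N d _ _ s≤m 0<N _ _ a 0<a M≡∏a^ = begin
  Rad (∏ m (λ j → M j / t)) ^ s * t ^ m ≤⟨ ∣⇒≤ {{>-nonZero 0<[∏A]^s}} Rad^s*t^m∣[∏A]^s ⟩
  ∏ m A ^ s                             ≤⟨ m≤n*m _ (primeProdUpTo m ^ s) {{C^s≢0}} ⟩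
  primeProdUpTo m ^ s * ∏ m A ^ s       ∎
  where
  open ≤-Reasoning
  s t : ℕ
  s = 2 * k ∸ 1
  t = gcd N d
  M A : Vector ℕ m
  M j = N + toℕ j * d
  A j = ∏ k (λ r → a r j)
  0<M : ∀ j → 0 < M j
  0<M j = ≤-trans 0<N (m≤m+n N _)
  0<A : ∀ j → 0 < A j
  0<A j = ∏-pos k (λ r → a r j) (λ r → 0<a r j)
  0<[∏A]^s : 0 < ∏ m A ^ s
  0<[∏A]^s = ^-pos (∏-pos m A 0<A) s
  C^s≢0 : NonZero (primeProdUpTo m ^ s)
  C^s≢0 = >-nonZero (^-pos (primeProdUpTo-pos m) s)
  t∣M : ∀ j → t ∣ M j
  t∣M j = ∣m∣n⇒∣m+n (gcd[m,n]∣m N d) (∣n⇒∣m*n (toℕ j) (gcd[m,n]∣n N d))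
  k+r≤s : (r : Fin k) → k + toℕ r ≤ s
  k+r≤s r = m+n≤o⇒m≤o∸n (k + toℕ r) (begin
    k + toℕ r + 1   ≡⟨ +-comm _ 1 ⟩
    suc (k + toℕ r) ≤⟨ +-monoʳ-< k (toℕ<n r) ⟩
    k + k           ≡⟨ cong (k +_) (+-identityʳ k) ⟨
    2 * k           ∎)
  vM≤vA : ∀ {p} → Prime p → ∀ j → valuation p (M j) ≤ s * valuation p (A j)
  vM≤vA {p} p-prime j = subst (λ x → valuation p x ≤ s * valuation p (A j)) (sym (M≡∏a^ j))
    (valuation-∏^≤ p-prime k (λ r → a r j) (λ r → k + toℕ r) (λ r → 0<a r j) k+r≤s)
  Rad^s*t^m∣[∏A]^s : Rad (∏ m (λ j → M j / t)) ^ s * t ^ m ∣ ∏ m A ^ s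
  Rad^s*t^m∣[∏A]^s = Rad[∏M/t]^s*t^m∣[∏A]^s M A s≤m 0<M 0<A t∣M vM≤vA
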